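{- Let $\alpha=a_n\omega^n+\cdots+a_1\omega+a_0$ be a nonzero ordinal of finite degree in Cantor normal form, and let $\mathrm{I}(\alpha)=\{\beta:\beta\text{ of finite degree},\ \mathrm{D}(\beta)=\alpha\}$. (1) If $a_0=0$, then $\mathrm{I}(\alpha)$ consists of the single ordinal $a_n\omega^{n+1}+\cdots+a_1\omega^2$. (2) If $a_0=1$, then $\mathrm{I}(\alpha)$ consists of $a_n\omega^{n+1}+\cdots+a_1\omega^2+\omega$ together with all ordinals $a_n\omega^{n+1}+\cdots+a_1\omega^2+j$ for $j\in\omega$, $j>0$. (3) If $a_0>1$, then $\mathrm{I}(\alpha)$ consists of $a_n\omega^{n+1}+\cdots+a_1\omega^2+a_0\omega$ together with all ordinals $a_n\omega^{n+1}+\cdots+a_1\omega^2+(a_0-1)\omega+j$ for $j\in\omega$, $j>0$.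
   Context: Products are lexicographic, so $a\omega^k$ denotes $a$ copies of $\omega^k$ laid end to end. For a linear order $L$, $x\sim_F y$ iff only finitely many points lie between $x$ and $y$; $L/\!\sim_F$ is the ordered set of classes. $\mathrm{D}(\alpha)$ is the ordinal isomorphic to $\alpha/\!\sim_F$. -}

module Defs where

open import Data.Nat using (ℕ; zero; suc; _<_)
open import Data.List using (List; []; _∷_)
open import Data.List.Relation.Unary.Any using (Any)
open import Data.Product using (Σ; ∃; _×_; _,_)
open import Data.Sum using (_⊎_)
open import Relation.Binary.PropositionalEquality using (_≡_)
open import Relation.Nullary using (¬_)

-- An ordinal of finite degree (i.e. an ordinal < ω^ω) in Cantor normal form,
-- given by its list of coefficients, little-endian:
--   a₀ ∷ a₁ ∷ … ∷ aₙ ∷ []   represents   aₙωⁿ + … + a₁ω + a₀.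
-- Trailing zeros are allowed; ordinal equality is _≈_ below.
Ord : Set
Ord = List ℕ

coeff : Ord → ℕ → ℕ
coeff []       k       = 0
coeff (a ∷ as) zero    = a
coeff (a ∷ as) (suc k) = coeff as k

_≈_ : Ord → Ord → Set
x ≈ y = ∀ k → coeff x k ≡ coeff y k

_<ₒ_ : Ord → Ord → Set
x <ₒ y = ∃ λ k → (coeff x k < coeff y k) × (∀ j → k < j → coeff x j ≡ coeff y j)

NonZeroOrd : Ord → Set
NonZeroOrd x = ∃ λ k → ¬ (coeff x k ≡ 0)

FiniteSet : (Ord → Set) → Set
FiniteSet P = ∃ λ (l : List Ord) → ∀ γ → P γ → Any (γ ≈_) l

-- The points of the ordinal β (as a linear order) are the ordinals γ <ₒ β.
-- x ∼F y in β: only finitely many points of β lie between x and y.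
Between : Ord → Ord → Ord → Set
Between x y γ = (x <ₒ γ × γ <ₒ y) ⊎ (y <ₒ γ × γ <ₒ x)

∼F : Ord → Ord → Ord → Set
∼F β x y = FiniteSet (λ γ → γ <ₒ β × Between x y γ)

-- D(β) = α: the ordered set of ∼F-classes of β is order-isomorphic to α.
-- Since quotients are unavailable, this is expressed by a map f from the
-- points of β onto the points of α whose fibres are exactly the ∼F-classes
-- and which is strictly increasing across distinct classes; it then induces
-- an order isomorphism β/∼F ≅ α.
DIs : Ord → Ord → Set
DIs β α = Σ (Ord → Ord) λ f →
    (∀ x → x <ₒ β → f x <ₒ α)
  × (∀ x y → x <ₒ β → y <ₒ β → (∼F β x y → f x ≈ f y) × (f x ≈ f y → ∼F β x y))
  × (∀ x y → x <ₒ β → y <ₒ β → x <ₒ y → ¬ ∼F β x y → f x <ₒ f y)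
  × (∀ z → z <ₒ α → ∃ λ x → x <ₒ β × f x ≈ z)

-- Two points of β are ∼F-equivalent exactly when they differ only in their
-- finite coefficient, so β/∼F is the order of the tails x/ω of the points x < β.
-- These tails are the ordinals below β/ω when β has no finite part, and the
-- ordinals up to β/ω otherwise; so β/∼F has the explicit order type D β below.
-- A presentation of D(β) = α yields an order isomorphism between the ordinals
-- D β and α, which forces α = D β, and the three cases are read off from this.
module Submission where

open import Defs
open import Data.Nat using (ℕ; zero; suc; _<_; _≤_; _∸_; _+_; z≤n; s≤s)
open import Data.Nat.Properties
  using (<-irrefl; <-trans; <-cmp; <-≤-trans; ≤-refl; ≤-trans; ≤-pred; m≤m+n; m≤n+m;
         m<1+n⇒m<n∨m≡n; suc-injective; 1+n≢0)
open import Data.List using (List; []; _∷_)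
open import Data.List.Relation.Unary.Any using (Any; here; there)
open import Data.Product using (_×_; ∃; _,_; proj₁; proj₂)
open import Data.Sum using (_⊎_; inj₁; inj₂)
open import Data.Empty using (⊥-elim)
open import Function using (_∘_)
open import Function.Bundles using (_⇔_; mk⇔; Equivalence)
open import Induction.WellFounded using (Acc; acc; WellFounded)
open import Relation.Binary using (tri<; tri≈; tri>)
open import Relation.Binary.PropositionalEquality using (_≡_; refl; sym; trans; cong; subst; subst₂)
open import Relation.Nullary using (¬_)

-- _≈_ and _<ₒ_ unfold to Π- and Σ-types from which Agda cannot infer the two
-- ordinals; these record wrappers make them inferable.
record _≋_ (x y : Ord) : Set where
  constructor ≋i
  field ≋o : x ≈ y
open _≋_

record _⊏_ (x y : Ord) : Set where
  constructor ⊏i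
  field ⊏o : x <ₒ y
open _⊏_

_⊑_ : Ord → Ord → Set
x ⊑ y = x ⊏ y ⊎ x ≋ y

-- x = ω · tl x + hd x
hd : Ord → ℕ
hd x = coeff x 0

tl : Ord → Ord
tl []       = []
tl (_ ∷ as) = as

coeff-tl : ∀ x k → coeff (tl x) k ≡ coeff x (suc k)
coeff-tl []       k = refl
coeff-tl (a ∷ as) k = refl

≋-refl : ∀ {x} → x ≋ x
≋-refl = ≋i λ _ → refl

≋-sym : ∀ {x y} → x ≋ y → y ≋ x
≋-sym (≋i e) = ≋i (sym ∘ e)

≋-trans : ∀ {x y z} → x ≋ y → y ≋ z → x ≋ z
≋-trans (≋i e) (≋i f) = ≋i λ k → trans (e k) (f k)

≋-hd : ∀ {x y} → x ≋ y → hd x ≡ hd y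
≋-hd (≋i e) = e 0

≋-tl : ∀ {x y} → x ≋ y → tl x ≋ tl y
≋-tl {x} {y} (≋i e) = ≋i λ k → trans (coeff-tl x k) (trans (e (suc k)) (sym (coeff-tl y k)))

hd-tl⇒≋ : ∀ {x y} → hd x ≡ hd y → tl x ≋ tl y → x ≋ y
hd-tl⇒≋ {x} {y} h (≋i e) = ≋i λ
  { zero    → h
  ; (suc k) → trans (sym (coeff-tl x k)) (trans (e k) (coeff-tl y k)) }

⊏-respˡ-≋ : ∀ {x x' y} → x ≋ x' → x ⊏ y → x' ⊏ y
⊏-respˡ-≋ (≋i e) (⊏i (k , lt , above)) =
  ⊏i (k , subst (_< _) (e k) lt , λ j k<j → trans (sym (e j)) (above j k<j))

⊏-respʳ-≋ : ∀ {x y y'} → y ≋ y' → x ⊏ y → x ⊏ y'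
⊏-respʳ-≋ (≋i e) (⊏i (k , lt , above)) =
  ⊏i (k , subst (_ <_) (e k) lt , λ j k<j → trans (above j k<j) (e j))

⊏-irrefl : ∀ {x} → ¬ x ⊏ x
⊏-irrefl (⊏i (_ , lt , _)) = <-irrefl refl lt

⊏⇒≭ : ∀ {x y} → x ⊏ y → ¬ x ≋ y
⊏⇒≭ lt e = ⊏-irrefl (⊏-respˡ-≋ e lt)

⊏-trans : ∀ {x y z} → x ⊏ y → y ⊏ z → x ⊏ z
⊏-trans {x = x} {z = z} (⊏i (k₁ , l₁ , a₁)) (⊏i (k₂ , l₂ , a₂)) with <-cmp k₁ k₂
... | tri< k₁<k₂ _ _ = ⊏i (k₂ , subst (_< coeff z k₂) (sym (a₁ k₂ k₁<k₂)) l₂ ,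
                          λ j k₂<j → trans (a₁ j (<-trans k₁<k₂ k₂<j)) (a₂ j k₂<j))
... | tri≈ _ refl _  = ⊏i (k₁ , <-trans l₁ l₂ , λ j k<j → trans (a₁ j k<j) (a₂ j k<j))
... | tri> _ _ k₂<k₁ = ⊏i (k₁ , subst (coeff x k₁ <_) (a₂ k₁ k₂<k₁) l₁ ,
                          λ j k₁<j → trans (a₁ j k₁<j) (a₂ j (<-trans k₂<k₁ k₁<j)))

⊏-asym : ∀ {x y} → x ⊏ y → ¬ y ⊏ x
⊏-asym x⊏y y⊏x = ⊏-irrefl (⊏-trans x⊏y y⊏x)

⊏-[] : ∀ {x} → ¬ x ⊏ []
⊏-[] (⊏i (_ , () , _))

⊑-squeeze : ∀ {x y z} → x ≋ z → x ⊑ y → y ⊑ z → y ≋ x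
⊑-squeeze _   (inj₂ x≋y) _            = ≋-sym x≋y
⊑-squeeze x≋z (inj₁ x⊏y) (inj₁ y⊏z) = ⊥-elim (⊏⇒≭ (⊏-trans x⊏y y⊏z) x≋z)
⊑-squeeze x≋z (inj₁ x⊏y) (inj₂ y≋z) = ⊥-elim (⊏⇒≭ x⊏y (≋-trans x≋z (≋-sym y≋z)))

tl-⊏⇒⊏ : ∀ {x y} → tl x ⊏ tl y → x ⊏ y
tl-⊏⇒⊏ {x} {y} (⊏i (k , lt , above)) =
  ⊏i (suc k , subst₂ _<_ (coeff-tl x k) (coeff-tl y k) lt , λ
    { zero    ()
    ; (suc j) (s≤s k<j) → trans (sym (coeff-tl x j)) (trans (above j k<j) (coeff-tl y j)) })

hd-<⇒⊏ : ∀ {x y} → tl x ≋ tl y → hd x < hd y → x ⊏ y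
hd-<⇒⊏ {x} {y} (≋i e) lt = ⊏i (zero , lt , λ
  { zero    ()
  ; (suc j) _ → trans (sym (coeff-tl x j)) (trans (e j) (coeff-tl y j)) })

⊏-split : ∀ {x y} → x ⊏ y → tl x ⊏ tl y ⊎ (tl x ≋ tl y × hd x < hd y)
⊏-split {x} {y} (⊏i (zero , lt , above)) =
  inj₂ (≋i (λ j → trans (coeff-tl x j) (trans (above (suc j) (s≤s z≤n)) (sym (coeff-tl y j)))) , lt)
⊏-split {x} {y} (⊏i (suc k , lt , above)) =
  inj₁ (⊏i (k , subst₂ _<_ (sym (coeff-tl x k)) (sym (coeff-tl y k)) lt ,
            λ j k<j → trans (coeff-tl x j) (trans (above (suc j) (s≤s k<j)) (sym (coeff-tl y j)))))

⊏⇒tl-⊑ : ∀ {x y} → x ⊏ y → tl x ⊑ tl y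
⊏⇒tl-⊑ x⊏y with ⊏-split x⊏y
... | inj₁ tl⊏ = inj₁ tl⊏
... | inj₂ (tl≋ , _) = inj₂ tl≋

data Cmp (x y : Ord) : Set where
  lt : x ⊏ y → Cmp x y
  eq : x ≋ y → Cmp x y
  gt : y ⊏ x → Cmp x y

cmp-by-tl : ∀ {x y} → Cmp (tl x) (tl y) → Cmp x y
cmp-by-tl (lt tl⊏) = lt (tl-⊏⇒⊏ tl⊏)
cmp-by-tl (gt tl⊐) = gt (tl-⊏⇒⊏ tl⊐)
cmp-by-tl {x} {y} (eq tl≋) with <-cmp (hd x) (hd y)
... | tri< hd< _ _ = lt (hd-<⇒⊏ tl≋ hd<)
... | tri≈ _ hd≡ _ = eq (hd-tl⇒≋ hd≡ tl≋)
... | tri> _ _ hd> = gt (hd-<⇒⊏ (≋-sym tl≋) hd>)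

⊏-cmp : ∀ x y → Cmp x y
⊏-cmp []       []       = eq ≋-refl
⊏-cmp []       (b ∷ bs) = cmp-by-tl (⊏-cmp [] bs)
⊏-cmp (a ∷ as) []       = cmp-by-tl (⊏-cmp as [])
⊏-cmp (a ∷ as) (b ∷ bs) = cmp-by-tl (⊏-cmp as bs)

acc-by-hd : ∀ {t} → (∀ {y} → tl y ⊏ t → Acc _⊏_ y) →
            ∀ n {y} → hd y < n → tl y ≋ t → Acc _⊏_ y
acc-by-hd below (suc n) {y} hy<n tl≋t = acc λ {y'} y'⊏y → split y' (⊏-split y'⊏y)
  where
  split : ∀ y' → tl y' ⊏ tl y ⊎ (tl y' ≋ tl y × hd y' < hd y) → Acc _⊏_ y'
  split _ (inj₁ tl⊏)         = below (⊏-respʳ-≋ tl≋t tl⊏)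
  split _ (inj₂ (tl≋ , hd<)) = acc-by-hd below n (<-≤-trans hd< (≤-pred hy<n)) (≋-trans tl≋ tl≋t)

acc-by-tl : ∀ {t} → Acc _⊏_ t → ∀ {y} → tl y ⊏ t → Acc _⊏_ y
acc-by-tl (acc rs) {y} tl⊏ = acc-by-hd (acc-by-tl (rs tl⊏)) (suc (hd y)) ≤-refl ≋-refl

⊏-wellFounded : WellFounded _⊏_
⊏-wellFounded []       = acc (⊥-elim ∘ ⊏-[])
⊏-wellFounded (a ∷ as) = acc-by-hd (acc-by-tl (⊏-wellFounded as)) (suc a) ≤-refl ≋-refl

-- An order isomorphism between the initial segments below γ and below α is
-- the identity, so γ = α.
module SegmentIso {γ α : Ord} (h : Ord → Ord)
  (h-⊏ : ∀ {z} → z ⊏ γ → h z ⊏ α)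
  (h-resp : ∀ {z z'} → z ⊏ γ → z' ⊏ γ → z ≋ z' → h z ≋ h z')
  (h-mono : ∀ {z z'} → z ⊏ γ → z' ⊏ γ → z ⊏ z' → h z ⊏ h z')
  (h-onto : ∀ {w} → w ⊏ α → ∃ λ z → z ⊏ γ × h z ≋ w)
  where

  h-fixed : ∀ {z} → Acc _⊏_ z → z ⊏ γ → h z ≋ z
  h-fixed {z} (acc rs) z⊏γ with ⊏-cmp (h z) z
  ... | eq hz≋z = hz≋z
  ... | lt hz⊏z = ⊥-elim (⊏-irrefl (⊏-respˡ-≋ (h-fixed (rs hz⊏z) hz⊏γ) (h-mono hz⊏γ z⊏γ hz⊏z)))
    where hz⊏γ = ⊏-trans hz⊏z z⊏γ
  ... | gt z⊏hz with h-onto (⊏-trans z⊏hz (h-⊏ z⊏γ))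
  ...   | w , w⊏γ , hw≋z with ⊏-cmp w z
  ...     | lt w⊏z = ⊥-elim (⊏⇒≭ w⊏z (≋-trans (≋-sym (h-fixed (rs w⊏z) w⊏γ)) hw≋z))
  ...     | eq w≋z = ⊥-elim (⊏⇒≭ z⊏hz (≋-trans (≋-sym hw≋z) (h-resp w⊏γ z⊏γ w≋z)))
  ...     | gt z⊏w = ⊥-elim (⊏-asym z⊏hz (⊏-respʳ-≋ hw≋z (h-mono z⊏γ w⊏γ z⊏w)))

  segments-≋ : γ ≋ α
  segments-≋ with ⊏-cmp γ α
  ... | eq γ≋α = γ≋α
  ... | gt α⊏γ = ⊥-elim (⊏⇒≭ (h-⊏ α⊏γ) (h-fixed (⊏-wellFounded α) α⊏γ))
  ... | lt γ⊏α with h-onto γ⊏α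
  ...   | w , w⊏γ , hw≋γ = ⊥-elim (⊏⇒≭ w⊏γ (≋-trans (≋-sym (h-fixed (⊏-wellFounded w) w⊏γ)) hw≋γ))

column : Ord → ℕ → List Ord
column t zero    = []
column t (suc n) = (n ∷ t) ∷ column t n

∈-column : ∀ {t γ} n → hd γ < n → tl γ ≋ t → Any (γ ≈_) (column t n)
∈-column {t} {γ} (suc n) hd<n tl≋t with m<1+n⇒m<n∨m≡n hd<n
... | inj₁ hd<n′ = there (∈-column {t} {γ} n hd<n′ tl≋t)
... | inj₂ refl  = here (≋o (hd-tl⇒≋ {γ} {n ∷ t} refl tl≋t))

hd-sum : List Ord → ℕ
hd-sum []       = 0
hd-sum (x ∷ xs) = hd x + hd-sum xs

∈⇒hd≤hd-sum : ∀ {γ} xs → Any (γ ≈_) xs → hd γ ≤ hd-sum xs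
∈⇒hd≤hd-sum (x ∷ xs) (here γ≈x)  = subst (_≤ hd x + hd-sum xs) (sym (γ≈x 0)) (m≤m+n (hd x) (hd-sum xs))
∈⇒hd≤hd-sum {γ} (x ∷ xs) (there γ∈) = ≤-trans (∈⇒hd≤hd-sum {γ} xs γ∈) (m≤n+m (hd-sum xs) (hd x))

between-same-tl : ∀ {x y γ} → tl x ≋ tl y → x ⊏ γ → γ ⊏ y → tl γ ≋ tl x × hd γ < hd y
between-same-tl tl≋ x⊏γ γ⊏y with ⊑-squeeze tl≋ (⊏⇒tl-⊑ x⊏γ) (⊏⇒tl-⊑ γ⊏y) | ⊏-split γ⊏y
... | tlγ≋ | inj₁ tlγ⊏ = ⊥-elim (⊏⇒≭ tlγ⊏ (≋-trans tlγ≋ tl≋))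
... | tlγ≋ | inj₂ (_ , hd<) = tlγ≋ , hd<

∼F-sym : ∀ β x y → ∼F β x y → ∼F β y x
∼F-sym β x y (xs , covers) = xs , λ γ (γ⊏β , between) → covers γ (γ⊏β , swap {γ} between)
  where
  swap : ∀ {γ} → Between y x γ → Between x y γ
  swap (inj₁ p) = inj₂ p
  swap (inj₂ p) = inj₁ p

-- Between two points with the same tail lie only points with that tail and a
-- smaller head, all of which occur in one finite column.
same-tl⇒∼F : ∀ β x y → tl x ≋ tl y → ∼F β x y
same-tl⇒∼F β x y tl≋ = column (tl x) (hd x + hd y) , λ γ → covered γ ∘ proj₂
  where
  covered : ∀ γ → Between x y γ → Any (γ ≈_) (column (tl x) (hd x + hd y))
  covered γ (inj₁ (x<γ , γ<y)) with between-same-tl {x} {y} {γ} tl≋ (⊏i x<γ) (⊏i γ<y)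
  ... | tlγ≋ , hd< = ∈-column {γ = γ} _ (<-≤-trans hd< (m≤n+m (hd y) (hd x))) tlγ≋
  covered γ (inj₂ (y<γ , γ<x)) with between-same-tl {y} {x} {γ} (≋-sym tl≋) (⊏i y<γ) (⊏i γ<x)
  ... | tlγ≋ , hd< = ∈-column {γ = γ} _ (<-≤-trans hd< (m≤m+n (hd x) (hd y))) (≋-trans tlγ≋ (≋-sym tl≋))

-- Every point N ∷ tl x with N > hd x lies between x and y, so no finite list
-- covers them: take N above the sum of all heads in the list.
tl-⊏⇒≁F : ∀ β x y → tl x ⊏ tl y → y ⊏ β → ¬ ∼F β x y
tl-⊏⇒≁F β x y tl⊏ y⊏β (xs , covers) =
  <-irrefl refl (<-≤-trans (s≤s (m≤n+m (hd-sum xs) (hd x))) (∈⇒hd≤hd-sum {γ} xs γ-covered))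
  where
  γ : Ord
  γ = suc (hd x + hd-sum xs) ∷ tl x
  γ⊏y : γ ⊏ y
  γ⊏y = tl-⊏⇒⊏ tl⊏
  γ⊏β : γ ⊏ β
  γ⊏β = ⊏-trans γ⊏y y⊏β
  x⊏γ : x ⊏ γ
  x⊏γ = hd-<⇒⊏ ≋-refl (s≤s (m≤m+n (hd x) (hd-sum xs)))
  γ-covered : Any (γ ≈_) xs
  γ-covered = covers γ (⊏o γ⊏β , inj₁ (⊏o x⊏γ , ⊏o γ⊏y))

∼F⇒same-tl : ∀ β x y → x ⊏ β → y ⊏ β → ∼F β x y → tl x ≋ tl y
∼F⇒same-tl β x y x⊏β y⊏β x∼y with ⊏-cmp (tl x) (tl y)
... | lt tl⊏ = ⊥-elim (tl-⊏⇒≁F β x y tl⊏ y⊏β x∼y)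
... | eq tl≋ = tl≋
... | gt tl⊐ = ⊥-elim (tl-⊏⇒≁F β y x tl⊐ x⊏β (∼F-sym β x y x∼y))

succ : Ord → Ord
succ t = suc (hd t) ∷ tl t

⊑⇒⊏succ : ∀ {δ t} → δ ⊑ t → δ ⊏ succ t
⊑⇒⊏succ (inj₁ δ⊏t) = ⊏-trans δ⊏t (hd-<⇒⊏ ≋-refl ≤-refl)
⊑⇒⊏succ (inj₂ δ≋t) = hd-<⇒⊏ (≋-tl δ≋t) (s≤s (subst (_≤ _) (sym (≋-hd δ≋t)) ≤-refl))

⊏succ⇒⊑ : ∀ {δ t} → δ ⊏ succ t → δ ⊑ t
⊏succ⇒⊑ δ⊏ with ⊏-split δ⊏
... | inj₁ tl⊏ = inj₁ (tl-⊏⇒⊏ tl⊏)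
... | inj₂ (tl≋ , hd<) with m<1+n⇒m<n∨m≡n hd<
...   | inj₁ hd<′ = inj₁ (hd-<⇒⊏ tl≋ hd<′)
...   | inj₂ hd≡  = inj₂ (hd-tl⇒≋ hd≡ tl≋)

succ-resp-≋ : ∀ {t u} → t ≋ u → succ t ≋ succ u
succ-resp-≋ t≋u = hd-tl⇒≋ (cong suc (≋-hd t≋u)) (≋-tl t≋u)

succ-injective-≋ : ∀ {t u} → succ t ≋ succ u → t ≋ u
succ-injective-≋ e = hd-tl⇒≋ (suc-injective (≋-hd e)) (≋-tl e)

-- The order type of β/∼F: one point for each ω-block below β, plus the block
-- of tl β itself when β has a nonzero finite part.
D : Ord → Ord
D []          = []
D (zero ∷ t)  = t
D (suc _ ∷ t) = succ t

tl-⊏-D : ∀ β {x} → x ⊏ β → tl x ⊏ D β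
tl-⊏-D []          x⊏β = ⊥-elim (⊏-[] x⊏β)
tl-⊏-D (zero ∷ t)  x⊏β with ⊏-split x⊏β
... | inj₁ tl⊏ = tl⊏
tl-⊏-D (suc _ ∷ t) x⊏β = ⊑⇒⊏succ (⊏⇒tl-⊑ x⊏β)

0∷-⊏ : ∀ β {z} → z ⊏ D β → (0 ∷ z) ⊏ β
0∷-⊏ []          z⊏D = ⊥-elim (⊏-[] z⊏D)
0∷-⊏ (zero ∷ t)  z⊏D = tl-⊏⇒⊏ z⊏D
0∷-⊏ (suc _ ∷ t) z⊏D with ⊏succ⇒⊑ z⊏D
... | inj₁ z⊏t = tl-⊏⇒⊏ z⊏t
... | inj₂ z≋t = hd-<⇒⊏ z≋t (s≤s z≤n)

tl-presents-D : ∀ β {α} → α ≋ D β → DIs β α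
tl-presents-D β {α} α≋D = tl , points , fibres , increasing , onto
  where
  points : ∀ x → x <ₒ β → tl x <ₒ α
  points x x<β = ⊏o (⊏-respʳ-≋ (≋-sym α≋D) (tl-⊏-D β {x} (⊏i x<β)))
  fibres : ∀ x y → x <ₒ β → y <ₒ β → (∼F β x y → tl x ≈ tl y) × (tl x ≈ tl y → ∼F β x y)
  fibres x y x<β y<β = ≋o ∘ ∼F⇒same-tl β x y (⊏i x<β) (⊏i y<β) , same-tl⇒∼F β x y ∘ ≋i
  increasing : ∀ x y → x <ₒ β → y <ₒ β → x <ₒ y → ¬ ∼F β x y → tl x <ₒ tl y
  increasing x y _ _ x<y x≁y with ⊏-split (⊏i {x} {y} x<y)
  ... | inj₁ tl⊏ = ⊏o tl⊏
  ... | inj₂ (tl≋ , _) = ⊥-elim (x≁y (same-tl⇒∼F β x y tl≋))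
  onto : ∀ z → z <ₒ α → ∃ λ x → x <ₒ β × tl x ≈ z
  onto z z<α = 0 ∷ z , ⊏o (0∷-⊏ β (⊏-respʳ-≋ α≋D (⊏i z<α))) , λ _ → refl

-- A presentation f of D(β) = α is constant on ω-blocks, so z ↦ f (0 ∷ z) is an
-- order isomorphism from the points of D β onto those of α.
DIs⇒≋D : ∀ β {α} → DIs β α → α ≋ D β
DIs⇒≋D β {α} (f , f-points , f-fibres , f-increasing , f-onto) =
  ≋-sym (SegmentIso.segments-≋ h h-⊏ h-resp h-mono h-onto)
  where
  h : Ord → Ord
  h z = f (0 ∷ z)
  point : ∀ {z} → z ⊏ D β → (0 ∷ z) <ₒ β
  point z⊏D = ⊏o (0∷-⊏ β z⊏D)
  f-block : ∀ {x y} → x <ₒ β → y <ₒ β → tl x ≋ tl y → f x ≋ f y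
  f-block {x} {y} x<β y<β tl≋ = ≋i (proj₁ (f-fibres x y x<β y<β) (same-tl⇒∼F β x y tl≋))
  h-⊏ : ∀ {z} → z ⊏ D β → h z ⊏ α
  h-⊏ z⊏D = ⊏i (f-points _ (point z⊏D))
  h-resp : ∀ {z z'} → z ⊏ D β → z' ⊏ D β → z ≋ z' → h z ≋ h z'
  h-resp z⊏D z'⊏D = f-block (point z⊏D) (point z'⊏D)
  h-mono : ∀ {z z'} → z ⊏ D β → z' ⊏ D β → z ⊏ z' → h z ⊏ h z'
  h-mono {z} {z'} z⊏D z'⊏D z⊏z' =
    ⊏i (f-increasing _ _ (point z⊏D) (point z'⊏D) (⊏o (tl-⊏⇒⊏ {0 ∷ z} {0 ∷ z'} z⊏z'))
          (⊏⇒≭ z⊏z' ∘ ∼F⇒same-tl β (0 ∷ z) (0 ∷ z') (0∷-⊏ β z⊏D) (0∷-⊏ β z'⊏D)))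
  h-onto : ∀ {w} → w ⊏ α → ∃ λ z → z ⊏ D β × h z ≋ w
  h-onto {w} w⊏α with f-onto w (⊏o w⊏α)
  ... | x , x<β , fx≈w = tl x , tlx⊏D , ≋-trans (f-block (point tlx⊏D) x<β ≋-refl) (≋i fx≈w)
    where tlx⊏D = tl-⊏-D β {x} (⊏i x<β)

≋D⇔ : ∀ β {α} → α ≋ D β ⇔ ((hd β ≡ 0 × tl β ≋ α) ⊎ (0 < hd β × succ (tl β) ≋ α))
≋D⇔ []          = mk⇔ (λ e → inj₁ (refl , ≋-sym e))
                        λ { (inj₁ (_ , e)) → ≋-sym e ; (inj₂ (() , _)) }
≋D⇔ (zero ∷ t)  = mk⇔ (λ e → inj₁ (refl , ≋-sym e))
                        λ { (inj₁ (_ , e)) → ≋-sym e ; (inj₂ (() , _)) }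
≋D⇔ (suc _ ∷ t) = mk⇔ (λ e → inj₂ (s≤s z≤n , ≋-sym e))
                        λ { (inj₁ (() , _)) ; (inj₂ (_ , e)) → ≋-sym e }

DIs⇔ : ∀ β {α} → DIs β α ⇔ ((hd β ≡ 0 × tl β ≋ α) ⊎ (0 < hd β × succ (tl β) ≋ α))
DIs⇔ β = mk⇔ (Equivalence.to (≋D⇔ β) ∘ DIs⇒≋D β) (tl-presents-D β ∘ Equivalence.from (≋D⇔ β))

DIs-0∷⇔ : ∀ as β → DIs β (0 ∷ as) ⇔ β ≈ (0 ∷ 0 ∷ as)
DIs-0∷⇔ as β = mk⇔ to from
  where
  to : DIs β (0 ∷ as) → β ≈ (0 ∷ 0 ∷ as)
  to d with Equivalence.to (DIs⇔ β) d
  ... | inj₁ (hd≡0 , tl≋) = ≋o (hd-tl⇒≋ {β} {0 ∷ 0 ∷ as} hd≡0 tl≋)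
  ... | inj₂ (_ , succ≋)  = ⊥-elim (1+n≢0 (≋-hd succ≋))
  from : β ≈ (0 ∷ 0 ∷ as) → DIs β (0 ∷ as)
  from e = Equivalence.from (DIs⇔ β) (inj₁ (≋-hd β≋ , ≋-tl β≋))
    where β≋ = ≋i {β} {0 ∷ 0 ∷ as} e

DIs-suc∷⇔ : ∀ c as β →
  DIs β (suc c ∷ as) ⇔ (β ≈ (0 ∷ suc c ∷ as) ⊎ ∃ λ j → 0 < j × β ≈ (j ∷ c ∷ as))
DIs-suc∷⇔ c as β = mk⇔ to from
  where
  to : DIs β (suc c ∷ as) → β ≈ (0 ∷ suc c ∷ as) ⊎ ∃ λ j → 0 < j × β ≈ (j ∷ c ∷ as)
  to d with Equivalence.to (DIs⇔ β) d
  ... | inj₁ (hd≡0 , tl≋)  = inj₁ (≋o (hd-tl⇒≋ {β} {0 ∷ suc c ∷ as} hd≡0 tl≋))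
  ... | inj₂ (0<hd , succ≋) =
    inj₂ (hd β , 0<hd , ≋o (hd-tl⇒≋ {β} {hd β ∷ c ∷ as} refl tl≋))
    where tl≋ = succ-injective-≋ {tl β} {c ∷ as} succ≋
  from : β ≈ (0 ∷ suc c ∷ as) ⊎ (∃ λ j → 0 < j × β ≈ (j ∷ c ∷ as)) → DIs β (suc c ∷ as)
  from (inj₁ e) = Equivalence.from (DIs⇔ β) (inj₁ (≋-hd β≋ , ≋-tl β≋))
    where β≋ = ≋i {β} {0 ∷ suc c ∷ as} e
  from (inj₂ (j , 0<j , e)) =
    Equivalence.from (DIs⇔ β) (inj₂ (subst (0 <_) (sym (≋-hd β≋)) 0<j , succ-resp-≋ (≋-tl β≋)))
    where β≋ = ≋i {β} {j ∷ c ∷ as} e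

mainTheorem8 : (a₀ : ℕ) (as : List ℕ) → NonZeroOrd (a₀ ∷ as) → (β : Ord) →
    (a₀ ≡ 0 → (DIs β (a₀ ∷ as) ⇔ β ≈ (0 ∷ 0 ∷ as)))
    × (a₀ ≡ 1 → (DIs β (a₀ ∷ as) ⇔ (β ≈ (0 ∷ 1 ∷ as) ⊎ ∃ λ j → 0 < j × β ≈ (j ∷ 0 ∷ as))))
    × (1 < a₀ → (DIs β (a₀ ∷ as) ⇔ (β ≈ (0 ∷ a₀ ∷ as) ⊎ ∃ λ j → 0 < j × β ≈ (j ∷ (a₀ ∸ 1) ∷ as))))
mainTheorem8 a₀ as _ β =
    (λ { refl → DIs-0∷⇔ as β })
  , (λ { refl → DIs-suc∷⇔ 0 as β })
  , λ { (s≤s (s≤s {n = c} _)) → DIs-suc∷⇔ (suc c) as β }
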